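{- For all $n\ge 2$ and $k\in[n]$, the map $\theta$ restricts to a bijection from $\mathcal{DU}_{n,k}$ onto $\mathcal{DU}'_{n,k}$, and $\theta(\pi)_2=\pi_2$ for every $\pi\in\mathcal{DU}_{n,k}$.
   Context: $[n]=\{1,\dots,n\}$. $\mathcal{DU}_n$ is the set of permutations $\pi=\pi_1\cdots\pi_n$ of $[n]$ with $\pi_1>\pi_2<\pi_3>\cdots$; $\mathcal{DU}_{n,k}$ is the subset with $\pi_1=k$; $\mathcal{DU}'_{n,k}$ is the set of $\pi\in\mathcal{DU}_n$ with $\pi_1-\pi_2=n+1-k$. For a permutation $\sigma$ of $[n]$, $\sigma\circ\pi$ is the word obtained by replacing each letter $\pi_i$ by $\sigma(\pi_i)$; the cycle $(c_1,c_2,\dots,c_r)$ is the permutation sending $c_1\mapsto c_2\mapsto\cdots\mapsto c_r\mapsto c_1$ and fixing all other elements. For $\pi\in\mathcal{DU}_{n,k}$ put $m=n-k+1+\pi_2$ and define: $\theta(\pi)=(m,m-1,\dots,k+1,k)\circ\pi$ if $k<m$; $\theta(\pi)=(m,m+1,\dots,k-1,k)\circ\pi$ if $k>m$; $\theta(\pi)=\pi$ if $k=m$. -}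

module Defs where

open import Data.Nat using (ℕ; zero; suc; _+_; _∸_; _≤_; _<_; _≤ᵇ_; _<ᵇ_; _≡ᵇ_)
open import Data.Nat.Properties using (<-trans; n<1+n)
open import Data.Bool using (Bool; true; false; not; if_then_else_; _∧_)
open import Data.Fin using (Fin; zero; suc; fromℕ<)
open import Data.Product using (_×_; Σ)
open import Relation.Binary.PropositionalEquality using (_≡_)

-- A word of length n: positions are Fin n (0-indexed), letters are naturals.
-- The paper's 1-indexed letter π_i is  π (i-1); so π_1 = π zero, π_2 = π (suc zero).
Word : ℕ → Set
Word n = Fin n → ℕ

IsPerm : (n : ℕ) → Word n → Set
IsPerm n π = (∀ i → 1 ≤ π i × π i ≤ n) × (∀ i j → π i ≡ π j → i ≡ j)

-- Is a descent required between 0-indexed positions i and i+1?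
-- (π_1 > π_2 < π_3 > ⋯ : descent at even 0-indexed i, ascent at odd i.)
descentAt : ℕ → Bool
descentAt zero = true
descentAt (suc i) = not (descentAt i)

Step : Bool → ℕ → ℕ → Set
Step true  a b = b < a
Step false a b = a < b

IsDownUp : (n : ℕ) → Word n → Set
IsDownUp n π = ∀ (i : ℕ) (p : suc i < n) →
  Step (descentAt i) (π (fromℕ< (<-trans (n<1+n i) p))) (π (fromℕ< p))

DU : (n : ℕ) → Word n → Set
DU n π = IsPerm n π × IsDownUp n π

-- 𝒟𝒰_{n,k}  (n ≥ 2 built into the length suc (suc n'))
DUk : (n : ℕ) → ℕ → Word (suc (suc n)) → Set
DUk n k π = DU (suc (suc n)) π × π zero ≡ k

-- 𝒟𝒰'_{n,k}: π ∈ 𝒟𝒰_n with π_1 - π_2 = n + 1 - k  (here the length is N = 2+n)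
DU'k : (n : ℕ) → ℕ → Word (suc (suc n)) → Set
DU'k n k π = DU (suc (suc n)) π × π zero ∸ π (suc zero) ≡ suc (suc (suc n)) ∸ k

cycleDown : ℕ → ℕ → ℕ → ℕ
cycleDown m k x =
  if x ≡ᵇ k then m else (if (k <ᵇ x) ∧ (x ≤ᵇ m) then x ∸ 1 else x)

cycleUp : ℕ → ℕ → ℕ → ℕ
cycleUp m k x =
  if x ≡ᵇ k then m else (if (m ≤ᵇ x) ∧ (x <ᵇ k) then suc x else x)

θ : (n : ℕ) → Word (suc (suc n)) → Word (suc (suc n))
θ n π i =
  if k <ᵇ m then cycleDown m k (π i)
  else (if m <ᵇ k then cycleUp m k (π i) else π i)
  where
  N = suc (suc n)
  k = π zero
  m = N ∸ k + 1 + π (suc zero)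

-- θ applies to π the cycle sending k = π₁ to m = n − k + 1 + π₂ and shifting every letter
-- strictly between k and m one step towards k. Since π₂ < k and π₂ < m, the letter π₂ is
-- fixed; every letter other than π₁ is moved monotonically, so the alternation pattern
-- survives, and the new first gap is m − π₂ = n + 1 − k. Conversely, for τ ∈ 𝒟𝒰'_{n,k}
-- the cycle sending τ₁ back to k yields the unique preimage.
module Submission where

open import Defs
open import Data.Nat
open import Data.Nat.Properties
open import Data.Bool using (true; false; if_then_else_)
open import Data.Empty using (⊥-elim)
open import Data.Fin using (zero; suc)
open import Data.Product using (_×_; _,_; Σ; proj₂)
open import Function using (_∘_)
open import Relation.Nullary using (¬_; yes; no)
open import Relation.Nullary.Reflects using (Reflects; ofʸ; ofⁿ; det; fromEquivalence)
open import Relation.Binary using (tri<; tri≈; tri>)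
open import Relation.Binary.PropositionalEquality

private
  variable
    m k x y : ℕ

reflects-true : ∀ {A : Set} {b} → Reflects A b → A → b ≡ true
reflects-true r a = det r (ofʸ a)

reflects-false : ∀ {A : Set} {b} → Reflects A b → ¬ A → b ≡ false
reflects-false r ¬a = det r (ofⁿ ¬a)

≡ᵇ-reflects-≡ : ∀ m n → Reflects (m ≡ n) (m ≡ᵇ n)
≡ᵇ-reflects-≡ m n = fromEquivalence (≡ᵇ⇒≡ m n) (≡⇒≡ᵇ m n)

≡ᵇ-true : x ≡ y → (x ≡ᵇ y) ≡ true
≡ᵇ-true = reflects-true (≡ᵇ-reflects-≡ _ _)

≡ᵇ-false : x ≢ y → (x ≡ᵇ y) ≡ false
≡ᵇ-false = reflects-false (≡ᵇ-reflects-≡ _ _)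

<ᵇ-true : x < y → (x <ᵇ y) ≡ true
<ᵇ-true = reflects-true (<ᵇ-reflects-< _ _)

<ᵇ-false : ¬ x < y → (x <ᵇ y) ≡ false
<ᵇ-false = reflects-false (<ᵇ-reflects-< _ _)

≤ᵇ-true : x ≤ y → (x ≤ᵇ y) ≡ true
≤ᵇ-true = reflects-true (≤ᵇ-reflects-≤ _ _)

≤ᵇ-false : ¬ x ≤ y → (x ≤ᵇ y) ≡ false
≤ᵇ-false = reflects-false (≤ᵇ-reflects-≤ _ _)

cycleDown-source : ∀ m k → cycleDown m k k ≡ m
cycleDown-source m k rewrite ≡ᵇ-true {k} refl = refl

cycleDown-below : ∀ m → x < k → cycleDown m k x ≡ x
cycleDown-below m x<k rewrite ≡ᵇ-false (<⇒≢ x<k) | <ᵇ-false (<⇒≯ x<k) = refl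

cycleDown-between : k < suc x → suc x ≤ m → cycleDown m k (suc x) ≡ x
cycleDown-between k<x x≤m
  rewrite ≡ᵇ-false (>⇒≢ k<x) | <ᵇ-true k<x | ≤ᵇ-true x≤m = refl

cycleDown-above : k < x → m < x → cycleDown m k x ≡ x
cycleDown-above k<x m<x
  rewrite ≡ᵇ-false (>⇒≢ k<x) | <ᵇ-true k<x | ≤ᵇ-false (<⇒≱ m<x) = refl

cycleUp-source : ∀ m k → cycleUp m k k ≡ m
cycleUp-source m k rewrite ≡ᵇ-true {k} refl = refl

cycleUp-below : x < m → x ≢ k → cycleUp m k x ≡ x
cycleUp-below x<m x≢k rewrite ≡ᵇ-false x≢k | ≤ᵇ-false (<⇒≱ x<m) = refl

cycleUp-between : m ≤ x → x < k → cycleUp m k x ≡ suc x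
cycleUp-between m≤x x<k rewrite ≡ᵇ-false (<⇒≢ x<k) | ≤ᵇ-true m≤x | <ᵇ-true x<k = refl

cycleUp-above : ∀ m → k < x → cycleUp m k x ≡ x
cycleUp-above {x = x} m k<x rewrite ≡ᵇ-false (>⇒≢ k<x) with m ≤ᵇ x
... | false = refl
... | true rewrite <ᵇ-false (<⇒≯ k<x) = refl

cycleUp∘cycleDown : k < m → ∀ x → cycleUp k m (cycleDown m k x) ≡ x
cycleUp∘cycleDown {k} {m} k<m x with <-cmp x k
... | tri< x<k _ _ rewrite cycleDown-below m x<k = cycleUp-below x<k (<⇒≢ (<-trans x<k k<m))
... | tri≈ _ refl _ rewrite cycleDown-source m x = cycleUp-source x m
cycleUp∘cycleDown {k} {m} k<m (suc x) | tri> _ _ k<x with suc x ≤? m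
... | yes x≤m rewrite cycleDown-between k<x x≤m = cycleUp-between (≤-pred k<x) x≤m
... | no x≰m rewrite cycleDown-above k<x (≰⇒> x≰m) = cycleUp-above k (≰⇒> x≰m)

cycleDown∘cycleUp : m < k → ∀ x → cycleDown k m (cycleUp m k x) ≡ x
cycleDown∘cycleUp {m} {k} m<k x with <-cmp x k
... | tri≈ _ refl _ rewrite cycleUp-source m x = cycleDown-source x m
... | tri> _ _ k<x rewrite cycleUp-above m k<x = cycleDown-above (<-trans m<k k<x) k<x
... | tri< x<k _ _ with m ≤? x
...   | yes m≤x rewrite cycleUp-between m≤x x<k = cycleDown-between (s≤s m≤x) x<k
...   | no m≰x rewrite cycleUp-below (≰⇒> m≰x) (<⇒≢ x<k) = cycleDown-below k (≰⇒> m≰x)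

cycleDown-between-pred : k < x → x ≤ m → cycleDown m k x ≡ pred x
cycleDown-between-pred {x = suc x} k<x x≤m = cycleDown-between k<x x≤m

cycleDown-≤ : ∀ m → x ≢ k → cycleDown m k x ≤ x
cycleDown-≤ {x} {k} m x≢k with <-cmp x k
... | tri< x<k _ _ = ≤-reflexive (cycleDown-below m x<k)
... | tri≈ _ x≡k _ = ⊥-elim (x≢k x≡k)
... | tri> _ _ k<x with x ≤? m
...   | yes x≤m = ≤-trans (≤-reflexive (cycleDown-between-pred k<x x≤m)) pred[n]≤n
...   | no x≰m = ≤-reflexive (cycleDown-above k<x (≰⇒> x≰m))

cycleDown-monotone : ∀ m → x ≢ k → y ≢ k → x < y → cycleDown m k x < cycleDown m k y
cycleDown-monotone {x} {k} {y} m x≢k y≢k x<y with <-cmp y k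
... | tri< y<k _ _ rewrite cycleDown-below m y<k | cycleDown-below m (<-trans x<y y<k) = x<y
... | tri≈ _ y≡k _ = ⊥-elim (y≢k y≡k)
... | tri> _ _ k<y with y ≤? m
...   | no y≰m rewrite cycleDown-above k<y (≰⇒> y≰m) = ≤-<-trans (cycleDown-≤ m x≢k) x<y
...   | yes y≤m rewrite cycleDown-between-pred k<y y≤m with <-cmp x k
...     | tri< x<k _ _ rewrite cycleDown-below m x<k = <-≤-trans x<k (<⇒≤pred k<y)
...     | tri≈ _ x≡k _ = ⊥-elim (x≢k x≡k)
...     | tri> _ _ k<x rewrite cycleDown-between-pred k<x (≤-trans (<⇒≤ x<y) y≤m) =
  pred-mono-< {{>-nonZero (≤-<-trans z≤n k<x)}} x<y

-- The cycle applied by θ: θ n π = rotate m (π zero) ∘ π.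
rotate : ℕ → ℕ → ℕ → ℕ
rotate m k x = if k <ᵇ m then cycleDown m k x else (if m <ᵇ k then cycleUp m k x else x)

rotate-down : k < m → ∀ x → rotate m k x ≡ cycleDown m k x
rotate-down k<m x rewrite <ᵇ-true k<m = refl

rotate-up : m < k → ∀ x → rotate m k x ≡ cycleUp m k x
rotate-up m<k x rewrite <ᵇ-false (<⇒≯ m<k) | <ᵇ-true m<k = refl

rotate-id : ∀ k x → rotate k k x ≡ x
rotate-id k x rewrite <ᵇ-false (<-irrefl {k} refl) = refl

rotate-source : ∀ m k → rotate m k k ≡ m
rotate-source m k with <-cmp k m
... | tri< k<m _ _ = trans (rotate-down k<m k) (cycleDown-source m k)
... | tri≈ _ refl _ = rotate-id k k
... | tri> _ _ m<k = trans (rotate-up m<k k) (cycleUp-source m k)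

rotate-below : x < k → x < m → rotate m k x ≡ x
rotate-below {x} {k} {m} x<k x<m with <-cmp k m
... | tri< k<m _ _ = trans (rotate-down k<m x) (cycleDown-below m x<k)
... | tri≈ _ refl _ = rotate-id k x
... | tri> _ _ m<k = trans (rotate-up m<k x) (cycleUp-below x<m (<⇒≢ x<k))

rotate-inverse : ∀ m k x → rotate k m (rotate m k x) ≡ x
rotate-inverse m k x with <-cmp k m
... | tri< k<m _ _ rewrite rotate-down k<m x | rotate-up k<m (cycleDown m k x) =
  cycleUp∘cycleDown k<m x
... | tri≈ _ refl _ rewrite rotate-id k x = rotate-id k x
... | tri> _ _ m<k rewrite rotate-up m<k x | rotate-down m<k (cycleUp m k x) =
  cycleDown∘cycleUp m<k x

rotate-injective : ∀ m k → rotate m k x ≡ rotate m k y → x ≡ y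
rotate-injective {x} {y} m k eq = begin
  x                         ≡⟨ rotate-inverse m k x ⟨
  rotate k m (rotate m k x) ≡⟨ cong (rotate k m) eq ⟩
  rotate k m (rotate m k y) ≡⟨ rotate-inverse m k y ⟩
  y                         ∎
  where open ≡-Reasoning

rotate-monotone-down : k < m → x ≢ k → y ≢ k → x < y → rotate m k x < rotate m k y
rotate-monotone-down {k} {m} {x} {y} k<m x≢k y≢k x<y
  rewrite rotate-down k<m x | rotate-down k<m y = cycleDown-monotone m x≢k y≢k x<y

rotate-avoids-target : ∀ m k → x ≢ k → rotate m k x ≢ m
rotate-avoids-target m k x≢k eq = x≢k (rotate-injective m k (trans eq (sym (rotate-source m k))))

-- For m < k the map rotate m k is inverse to rotate k m, which is monotone off m.
rotate-monotone : ∀ m k → x ≢ k → y ≢ k → x < y → rotate m k x < rotate m k y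
rotate-monotone {x} {y} m k x≢k y≢k x<y with <-cmp k m
... | tri< k<m _ _ = rotate-monotone-down k<m x≢k y≢k x<y
... | tri≈ _ refl _ rewrite rotate-id k x | rotate-id k y = x<y
... | tri> _ _ m<k = ≤∧≢⇒< (≮⇒≥ not-reversed) ((<⇒≢ x<y) ∘ rotate-injective m k)
  where
  not-reversed : ¬ rotate m k y < rotate m k x
  not-reversed reversed = <⇒≯ x<y (subst₂ _<_ (rotate-inverse m k y) (rotate-inverse m k x)
    (rotate-monotone-down m<k (rotate-avoids-target m k y≢k) (rotate-avoids-target m k x≢k) reversed))

InRange : ℕ → ℕ → Set
InRange N x = 1 ≤ x × x ≤ N

cycleDown-range : ∀ {N} → InRange N m → InRange N k → InRange N x → InRange N (cycleDown m k x)
cycleDown-range {m} {k} {x} m∈ (1≤k , _) x∈@(_ , x≤N) with <-cmp x k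
... | tri< x<k _ _ rewrite cycleDown-below m x<k = x∈
... | tri≈ _ refl _ rewrite cycleDown-source m x = m∈
... | tri> _ _ k<x with x ≤? m
...   | yes x≤m rewrite cycleDown-between-pred k<x x≤m =
  ≤-trans 1≤k (<⇒≤pred k<x) , ≤-trans pred[n]≤n x≤N
...   | no x≰m rewrite cycleDown-above k<x (≰⇒> x≰m) = x∈

cycleUp-range : ∀ {N} → InRange N m → InRange N k → InRange N x → InRange N (cycleUp m k x)
cycleUp-range {m} {k} {x} m∈ (_ , k≤N) x∈ with <-cmp x k
... | tri≈ _ refl _ rewrite cycleUp-source m x = m∈
... | tri> _ _ k<x rewrite cycleUp-above m k<x = x∈
... | tri< x<k _ _ with m ≤? x
...   | yes m≤x rewrite cycleUp-between m≤x x<k = s≤s z≤n , ≤-trans x<k k≤N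
...   | no m≰x rewrite cycleUp-below (≰⇒> m≰x) (<⇒≢ x<k) = x∈

rotate-range : ∀ {N} → InRange N m → InRange N k → InRange N x → InRange N (rotate m k x)
rotate-range {m} {k} {x} m∈ k∈ x∈ with <-cmp k m
... | tri< k<m _ _ rewrite rotate-down k<m x = cycleDown-range m∈ k∈ x∈
... | tri≈ _ refl _ rewrite rotate-id k x = x∈
... | tri> _ _ m<k rewrite rotate-up m<k x = cycleUp-range m∈ k∈ x∈

Step-map : ∀ {f : ℕ → ℕ} {a d} b →
  (a < d → f a < f d) → (d < a → f d < f a) → Step b a d → Step b (f a) (f d)
Step-map true  _ descent d<a = descent d<a
Step-map false ascent _ a<d = ascent a<d

-- Only the first step involves π zero; all later letters avoid it, where f is monotone.
IsDownUp-map : ∀ {n} (π : Word (suc (suc n))) (f : ℕ → ℕ) →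
  (∀ i j → π i ≡ π j → i ≡ j) →
  (∀ {x y} → x ≢ π zero → y ≢ π zero → x < y → f x < f y) →
  f (π (suc zero)) < f (π zero) →
  IsDownUp (suc (suc n)) π → IsDownUp (suc (suc n)) (f ∘ π)
IsDownUp-map π f injective monotone first-descent du zero p = first-descent
IsDownUp-map π f injective monotone first-descent du (suc i) p =
  Step-map {f = f} (descentAt (suc i))
    (monotone avoids-head avoids-head) (monotone avoids-head avoids-head) (du (suc i) p)
  where
  avoids-head : ∀ {i} → π (suc i) ≢ π zero
  avoids-head eq with injective _ _ eq
  ... | ()

second<first : ∀ {n} {π : Word (suc (suc n))} → DU (suc (suc n)) π → π (suc zero) < π zero
second<first (_ , du) = du zero (s≤s (s≤s z≤n))

rotateHead-DU : ∀ {n} (π : Word (suc (suc n))) c →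
  DU (suc (suc n)) π → InRange (suc (suc n)) c → π (suc zero) < c →
  DU (suc (suc n)) (rotate c (π zero) ∘ π)
rotateHead-DU π c dπ@((range , injective) , du) c∈ second<c =
  ((λ i → rotate-range c∈ (range zero) (range i)) ,
   (λ i j → injective i j ∘ rotate-injective c (π zero))) ,
  IsDownUp-map π (rotate c (π zero)) injective (rotate-monotone c (π zero)) first-descent du
  where
  first-descent : rotate c (π zero) (π (suc zero)) < rotate c (π zero) (π zero)
  first-descent rewrite rotate-below (second<first dπ) second<c | rotate-source c (π zero) = second<c

θ-target : ℕ → ℕ → ℕ → ℕ
θ-target N k j = N ∸ k + 1 + j

θ-target-offset : ∀ {N k} → k ≤ N → N ∸ k + 1 ≡ suc N ∸ k
θ-target-offset {N} {k} k≤N = trans (+-comm (N ∸ k) 1) (sym (+-∸-assoc 1 k≤N))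

θ-target-∸ : ∀ {N k} j → k ≤ N → θ-target N k j ∸ j ≡ suc N ∸ k
θ-target-∸ {N} {k} j k≤N = trans (m+n∸n≡m (N ∸ k + 1) j) (θ-target-offset k≤N)

θ-target-> : ∀ N k j → j < θ-target N k j
θ-target-> N k j = m<n+m j (m≤n+m 1 (N ∸ k))

θ-target-≤ : ∀ {N k j} → k ≤ N → j < k → θ-target N k j ≤ N
θ-target-≤ {N} {k} {j} k≤N j<k = begin
  N ∸ k + 1 + j   ≡⟨ +-assoc (N ∸ k) 1 j ⟩
  N ∸ k + suc j   ≤⟨ +-monoʳ-≤ (N ∸ k) j<k ⟩
  N ∸ k + k       ≡⟨ m∸n+n≡m k≤N ⟩
  N               ∎
  where open ≤-Reasoning

θ-target-≤⇒< : ∀ {N k j} → k ≤ N → θ-target N k j ≤ N → j < k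
θ-target-≤⇒< {N} {k} {j} k≤N target≤N = +-cancelˡ-≤ (N ∸ k) (suc j) k (begin
  N ∸ k + suc j   ≡⟨ +-assoc (N ∸ k) 1 j ⟨
  θ-target N k j  ≤⟨ target≤N ⟩
  N               ≡⟨ m∸n+n≡m k≤N ⟨
  N ∸ k + k       ∎)
  where open ≤-Reasoning

θ-target-unique : ∀ {N k j M} → k ≤ N → j < M → M ∸ j ≡ suc N ∸ k → θ-target N k j ≡ M
θ-target-unique {N} {k} {j} {M} k≤N j<M gap = begin
  N ∸ k + 1 + j ≡⟨ cong (_+ j) (θ-target-offset k≤N) ⟩
  suc N ∸ k + j ≡⟨ cong (_+ j) gap ⟨
  M ∸ j + j     ≡⟨ m∸n+n≡m (<⇒≤ j<M) ⟩
  M             ∎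
  where open ≡-Reasoning

module _ {n : ℕ} where

  private
    N : ℕ
    N = suc (suc n)

  θ-second : ∀ {k} {π : Word N} → DUk n k π → θ n π (suc zero) ≡ π (suc zero)
  θ-second {π = π} (dπ , _) = rotate-below (second<first dπ) (θ-target-> N (π zero) (π (suc zero)))

  θ-DU' : ∀ {k} {π : Word N} → k ≤ N → DUk n k π → DU'k n k (θ n π)
  θ-DU' {π = π} k≤N dπk@(dπ , refl) = rotateHead-DU π target dπ target∈ j<target , gap
    where
    j : ℕ
    j = π (suc zero)
    target : ℕ
    target = θ-target N (π zero) j
    j<target : j < target
    j<target = θ-target-> N (π zero) j
    target∈ : InRange N target
    target∈ = ≤-<-trans z≤n j<target , θ-target-≤ k≤N (second<first dπ)
    gap : θ n π zero ∸ θ n π (suc zero) ≡ suc N ∸ π zero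
    gap = begin
      θ n π zero ∸ θ n π (suc zero) ≡⟨ cong₂ _∸_ (rotate-source target (π zero)) (θ-second dπk) ⟩
      target ∸ j                    ≡⟨ θ-target-∸ j k≤N ⟩
      suc N ∸ π zero                ∎
      where open ≡-Reasoning

  θ-injective : ∀ {k} {π σ : Word N} → DUk n k π → DUk n k σ →
    (∀ i → θ n π i ≡ θ n σ i) → ∀ i → π i ≡ σ i
  θ-injective {π = π} {σ} dπ@(_ , refl) dσ@(_ , σ₁≡π₁) θπ≡θσ i =
    rotate-injective (θ-target N (π zero) (π (suc zero))) (π zero) (begin
      θ n π i ≡⟨ θπ≡θσ i ⟩
      θ n σ i ≡⟨ cong₂ (λ a b → rotate (θ-target N a b) a (σ i)) σ₁≡π₁ (sym same-second) ⟩
      rotate (θ-target N (π zero) (π (suc zero))) (π zero) (σ i) ∎)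
    where
    open ≡-Reasoning
    same-second : π (suc zero) ≡ σ (suc zero)
    same-second = trans (sym (θ-second dπ)) (trans (θπ≡θσ (suc zero)) (θ-second dσ))

  θ-surjective : ∀ {k} → 1 ≤ k → k ≤ N → (τ : Word N) → DU'k n k τ →
    Σ (Word N) (λ π → DUk n k π × (∀ i → θ n π i ≡ τ i))
  θ-surjective {k} 1≤k k≤N τ (dτ@((range , _) , _) , gap) =
    π , (rotateHead-DU τ k dτ (1≤k , k≤N) j<k , head) , θπ≡τ
    where
    M : ℕ
    M = τ zero
    j : ℕ
    j = τ (suc zero)
    j<M : j < M
    j<M = second<first dτ
    target≡M : θ-target N k j ≡ M
    target≡M = θ-target-unique k≤N j<M gap
    j<k : j < k
    j<k = θ-target-≤⇒< k≤N (subst (_≤ N) (sym target≡M) (proj₂ (range zero)))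
    π : Word N
    π = rotate k M ∘ τ
    head : π zero ≡ k
    head = rotate-source k M
    second : π (suc zero) ≡ j
    second = rotate-below j<M j<k
    θπ≡τ : ∀ i → θ n π i ≡ τ i
    θπ≡τ i = begin
      rotate (θ-target N (π zero) (π (suc zero))) (π zero) (π i)
        ≡⟨ cong₂ (λ a b → rotate (θ-target N a b) a (π i)) head second ⟩
      rotate (θ-target N k j) k (rotate k M (τ i))
        ≡⟨ cong (λ c → rotate c k (rotate k M (τ i))) target≡M ⟩
      rotate M k (rotate k M (τ i))
        ≡⟨ rotate-inverse k M (τ i) ⟩
      τ i ∎
      where open ≡-Reasoning

theorem6 : (n k : ℕ) → 1 ≤ k → k ≤ suc (suc n) →
    ((π : Word (suc (suc n))) → DUk n k π → DU'k n k (θ n π))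
    × ((π σ : Word (suc (suc n))) → DUk n k π → DUk n k σ →
         (∀ i → θ n π i ≡ θ n σ i) → ∀ i → π i ≡ σ i)
    × ((τ : Word (suc (suc n))) → DU'k n k τ →
         Σ (Word (suc (suc n))) (λ π → DUk n k π × (∀ i → θ n π i ≡ τ i)))
    × ((π : Word (suc (suc n))) → DUk n k π → θ n π (suc zero) ≡ π (suc zero))
theorem6 n k 1≤k k≤N =
  (λ _ → θ-DU' k≤N) ,
  (λ _ _ → θ-injective) ,
  θ-surjective 1≤k k≤N ,
  (λ _ → θ-second)
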